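{- For any backward trie $\mathsf{T}_{\mathsf{b}}$ with $n$ nodes over any alphabet, $\mathsf{DAWG}(\mathsf{T}_{\mathsf{b}})$ has $O(n^2)$ nodes and $O(n^2)$ edges. For an alphabet of constant size or larger, there exist backward tries $\mathsf{T}_{\mathsf{b}}$ with $n$ nodes (for arbitrarily large $n$) such that $\mathsf{DAWG}(\mathsf{T}_{\mathsf{b}})$ has $\Omega(n^2)$ nodes and $\Omega(n^2)$ edges.
   Context: Let $\Sigma$ be an ordered alphabet. A forward trie $\mathsf{T}_{\mathsf{f}}$ is a rooted tree with edges labeled by single characters of $\Sigma$, out-going edges of each node having distinct labels. The backward trie $\mathsf{T}_{\mathsf{b}}$ is obtained from $\mathsf{T}_{\mathsf{f}}$ by reversing every edge (keeping labels); its "leaves" and "root" are those of $\mathsf{T}_{\mathsf{f}}$. For $v$ a descendant of $u$, $\mathit{str}_{\mathsf{b}}(v,u)$ is the string read along the reversed path from $v$ up to $u$. $\mathit{Substr}(\mathsf{T}_{\mathsf{b}})=\{\mathit{str}_{\mathsf{b}}(v,u): v \text{ a descendant of } u\}$. A string $Y\in\mathit{Substr}(\mathsf{T}_{\mathsf{b}})$ is left-maximal on $\mathsf{T}_{\mathsf{b}}$ if either there are distinct $a,b\in\Sigma$ with $aY,bY\in\mathit{Substr}(\mathsf{T}_{\mathsf{b}})$, or $Y=\mathit{str}_{\mathsf{b}}(v,u)$ for some leaf $v$. For $Y\in\mathit{Substr}(\mathsf{T}_{\mathsf{b}})$, $\mathit{l\text{ - }mxml}_{\mathsf{b}}(Y)$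 is the shortest left-maximal string of the form $\gamma Y$, $\gamma\in\Sigma^*$. The DAWG $\mathsf{DAWG}(\mathsf{T}_{\mathsf{b}})$ has one node for each equivalence class of $\mathit{Substr}(\mathsf{T}_{\mathsf{b}})$ under $Y\equiv Y'$ iff $\mathit{l\text{ - }mxml}_{\mathsf{b}}(Y)=\mathit{l\text{ - }mxml}_{\mathsf{b}}(Y')$, and an edge labeled $a$ from the class of $Y$ to the class of $Ya$ whenever $Y,Ya\in\mathit{Substr}(\mathsf{T}_{\mathsf{b}})$, $a\in\Sigma$. Convention: the root of the trie is connected to an auxiliary node $\bot$ by an edge labeled by a unique character $\$$ occurring nowhere else. -}

module Defs where

open import Data.Nat using (ℕ; zero; suc; _+_)
open import Data.Maybe using (Maybe; just; nothing)
open import Data.List using (List; []; _∷_; [_]; map; _++_; reverse; concatMap; length)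
open import Data.List.Membership.Propositional using (_∈_)
open import Data.List.Relation.Unary.All using (All)
open import Data.List.Relation.Unary.AllPairs using (AllPairs)
open import Data.List.Relation.Unary.Unique.Propositional using (Unique)
open import Data.Product using (Σ; _×_; _,_; proj₁; proj₂)
open import Data.Sum using (_⊎_)
open import Data.Nat using (_≤_)
open import Relation.Nullary using (¬_)
open import Relation.Binary.PropositionalEquality using (_≡_; _≢_)

data Trie (A : Set) : Set where
  node : List (A × Trie A) → Trie A

data WellFormed {A : Set} : Trie A → Set where
  wf : ∀ {cs : List (A × Trie A)} →
       Unique (map proj₁ cs) →
       All (λ c → WellFormed (proj₂ c)) cs →
       WellFormed (node cs)

mutual
  size : {A : Set} → Trie A → ℕ
  size (node cs) = suc (sizeL cs)

  sizeL : {A : Set} → List (A × Trie A) → ℕ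
  sizeL [] = zero
  sizeL ((_ , t) ∷ cs) = size t + sizeL cs

mutual
  mapT : {A B : Set} → (A → B) → Trie A → Trie B
  mapT f (node cs) = node (mapL f cs)

  mapL : {A B : Set} → (A → B) → List (A × Trie A) → List (B × Trie B)
  mapL f [] = []
  mapL f ((a , t) ∷ cs) = (f a , mapT f t) ∷ mapL f cs

-- Characters of the augmented trie: 'just a' for a ∈ Σ, 'nothing' is $.
Char : Set → Set
Char A = Maybe A

-- Convention: the root is connected to an auxiliary node ⊥ by an edge $.
augment : {A : Set} → Trie A → Trie (Char A)
augment t = node [ (nothing , mapT just t) ]

mutual
  downs : {B : Set} → Trie B → List (List B)
  downs (node cs) = [] ∷ downsL cs

  downsL : {B : Set} → List (B × Trie B) → List (List B)
  downsL [] = []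
  downsL ((a , t) ∷ cs) = map (a ∷_) (downs t) ++ downsL cs

mutual
  leafDowns : {B : Set} → Trie B → List (List B)
  leafDowns (node []) = [ [] ]
  leafDowns (node (c ∷ cs)) = leafDownsL (c ∷ cs)

  leafDownsL : {B : Set} → List (B × Trie B) → List (List B)
  leafDownsL [] = []
  leafDownsL ((a , t) ∷ cs) = map (a ∷_) (leafDowns t) ++ leafDownsL cs

mutual
  subtrees : {B : Set} → Trie B → List (Trie B)
  subtrees (node cs) = node cs ∷ subtreesL cs

  subtreesL : {B : Set} → List (B × Trie B) → List (Trie B)
  subtreesL [] = []
  subtreesL ((_ , t) ∷ cs) = subtrees t ++ subtreesL cs

-- The backward trie T_b of T (with the ⊥/$ convention).
-- str_b(v,u) is the reverse of the downward label path from u to v.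

Substr : {A : Set} → Trie A → List (List (Char A))
Substr T = map reverse (concatMap downs (subtrees (augment T)))

LeafStr : {A : Set} → Trie A → List (List (Char A))
LeafStr T = map reverse (concatMap leafDowns (subtrees (augment T)))

-- Left-maximality on T_b (a, b range over Σ, not over $).
LeftMaximal : {A : Set} → Trie A → List (Char A) → Set
LeftMaximal {A} T Y =
  Y ∈ Substr T ×
  ((Σ A λ a → Σ A λ b → a ≢ b × (just a ∷ Y) ∈ Substr T × (just b ∷ Y) ∈ Substr T)
   ⊎ Y ∈ LeafStr T)

IsLMxml : {A : Set} → Trie A → List (Char A) → List (Char A) → Set
IsLMxml {A} T Y Z =
  Σ (List (Char A)) λ γ →
    Z ≡ γ ++ Y × LeftMaximal T Z ×
    (∀ (γ′ : List (Char A)) → LeftMaximal T (γ′ ++ Y) → length γ ≤ length γ′)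

Equiv : {A : Set} → Trie A → List (Char A) → List (Char A) → Set
Equiv {A} T Y Y′ = Σ (List (Char A)) λ Z → IsLMxml T Y Z × IsLMxml T Y′ Z

-- Nodes of DAWG(T_b) are the ≡-classes of Substr(T_b); a list of
-- substrings lying in pairwise distinct classes is a family of distinct
-- DAWG nodes, so "#nodes ≤ k" is "every such family has length ≤ k" and
-- "#nodes ≥ k" is "some such family has length ≥ k".

DistinctNodes : {A : Set} → Trie A → List (List (Char A)) → Set
DistinctNodes T L = All (_∈ Substr T) L × AllPairs (λ Y Y′ → ¬ Equiv T Y Y′) L

-- An edge is presented by (Y , a) with Y, Ya ∈ Substr(T_b), a ∈ Σ; it is the
-- edge labelled a from [Y] to [Ya].
SameEdge : {A : Set} → Trie A → (List (Char A) × A) → (List (Char A) × A) → Set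
SameEdge T (Y , a) (Y′ , a′) =
  Equiv T Y Y′ × a ≡ a′ × Equiv T (Y ++ [ just a ]) (Y′ ++ [ just a′ ])

IsEdge : {A : Set} → Trie A → (List (Char A) × A) → Set
IsEdge T (Y , a) = Y ∈ Substr T × (Y ++ [ just a ]) ∈ Substr T

DistinctEdges : {A : Set} → Trie A → List (List (Char A) × A) → Set
DistinctEdges T E = All (IsEdge T) E × AllPairs (λ e e′ → ¬ SameEdge T e e′) E

{-# OPTIONS --safe #-}
module Submission where

-- Upper bound: distinct DAWG nodes have distinct representatives in Substr(T_b), and distinct edges
-- (Y, a) have distinct targets Ya in Substr(T_b).  Substr(T_b) lists one string per pair of a node v
-- of the augmented trie and an ancestor u of v, so it has at most (n + 1)² ≤ 4n² entries.
--
-- Lower bound: hang a complete binary tree of depth k over {x, y}, with p = 2^k leaves, below a path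
-- of p + 1 edges labelled x, so n = 3p.  For a leaf code c and j ≤ p + 1, the string reverse (x^j c)
-- read from a leaf up to a node of the path ends at a leaf, so it is left-maximal and hence its own
-- l-mxml: these (p + 2)p distinct strings lie in distinct classes.  For j ≤ p, appending x yields
-- the left-maximal reverse (x^(j+1) c), so the pairs (reverse (x^j c), x) are (p + 1)p distinct edges.

open import Defs
open import Data.Nat using (ℕ; zero; suc; _+_; _*_; _^_; _≤_; _<_; z≤n; s≤s)
open import Data.Nat.Properties
open import Data.Nat.Induction using (<-rec)
open import Data.Nat.Solver using (module +-*-Solver)
open import Data.Fin using (Fin) renaming (zero to fzero; suc to fsuc)
open import Data.Maybe using (just)
open import Data.List using (List; []; _∷_; [_]; map; _++_; reverse; concatMap; length; replicate)
open import Data.List.Properties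
  using (length-++; length-map; length-removeAt′; ++-identityʳ; ++-cancelˡ; reverse-++; reverse-injective;
         unfold-reverse; length-replicate; ∷-injective; ∷ʳ-injective; concatMap-++)
open import Data.List.Membership.Propositional using (_∈_; _─_; lose; find)
open import Data.List.Membership.Propositional.Properties
  using (∈-map⁺; ∈-map⁻; ∈-++⁺ˡ; ∈-++⁺ʳ; ∈-++⁻; ∈-concatMap⁺; ∈-concatMap⁻)
open import Data.List.Relation.Unary.Any using (here; there; index)
open import Data.List.Relation.Unary.All using (All; []; _∷_)
import Data.List.Relation.Unary.All as All
import Data.List.Relation.Unary.All.Properties as All
open import Data.List.Relation.Unary.AllPairs using (AllPairs; []; _∷_)
import Data.List.Relation.Unary.AllPairs.Properties as AllPairs
open import Data.List.Relation.Unary.Unique.Propositional using (Unique)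
import Data.List.Relation.Unary.Unique.Propositional.Properties as Unique
open import Data.Product using (Σ; _×_; _,_; proj₁; proj₂)
open import Data.Sum using (inj₁; inj₂)
open import Data.Empty using (⊥-elim)
open import Relation.Nullary using (¬_)
open import Relation.Binary.PropositionalEquality
  using (_≡_; _≢_; refl; sym; trans; cong; cong₂; subst; module ≡-Reasoning)

module _ {X : Set} where

  ∈-─⁺ : ∀ {x y : X} {ys} (x∈ : x ∈ ys) → y ∈ ys → x ≢ y → y ∈ ys ─ x∈
  ∈-─⁺ (here refl) (here refl) x≢y = ⊥-elim (x≢y refl)
  ∈-─⁺ (here _)    (there y∈)  _   = y∈
  ∈-─⁺ (there _)   (here y≡)   _   = here y≡
  ∈-─⁺ (there x∈)  (there y∈)  x≢y = there (∈-─⁺ x∈ y∈ x≢y)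

  Unique⇒length≤ : ∀ {xs ys : List X} → Unique xs → All (_∈ ys) xs → length xs ≤ length ys
  Unique⇒length≤ [] [] = z≤n
  Unique⇒length≤ {ys = ys} (x∉xs ∷ xs!) (x∈ ∷ xs⊆) =
    subst (_ ≤_) (sym (length-removeAt′ ys (index x∈)))
      (s≤s (Unique⇒length≤ xs! (All.zipWith (λ (x≢y , y∈) → ∈-─⁺ x∈ y∈ x≢y) (x∉xs , xs⊆))))

  AllPairs-map-restricted : {P : X → Set} {R S : X → X → Set} →
                            (∀ {x y} → P x → P y → R x y → S x y) →
                            ∀ {xs} → All P xs → AllPairs R xs → AllPairs S xs
  AllPairs-map-restricted f [] [] = []
  AllPairs-map-restricted f (px ∷ pxs) (rx ∷ rxs) =
    All.zipWith (λ (py , r) → f px py r) (pxs , rx) ∷ AllPairs-map-restricted f pxs rxs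

¬¬-least : (P : ℕ → Set) → ∀ n → P n → ¬ ¬ (Σ ℕ λ m → P m × (∀ k → P k → m ≤ k))
¬¬-least P = <-rec _ λ n below pn noLeast →
  noLeast (n , pn , λ k pk → ≮⇒≥ λ k<n → below k<n pk noLeast)

m²+n²≤[m+n]² : ∀ m n → m * m + n * n ≤ (m + n) * (m + n)
m²+n²≤[m+n]² m n = begin
  m * m + n * n              ≤⟨ +-mono-≤ (*-monoʳ-≤ m (m≤m+n m n)) (*-monoʳ-≤ n (m≤n+m n m)) ⟩
  m * (m + n) + n * (m + n)  ≡⟨ *-distribʳ-+ (m + n) m n ⟨
  (m + n) * (m + n)          ∎
  where open ≤-Reasoning

n<2^n : ∀ n → n < 2 ^ n
n<2^n zero = s≤s z≤n
n<2^n (suc n) = begin-strict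
  suc n          ≤⟨ n<2^n n ⟩
  2 ^ n          <⟨ m<m+n (2 ^ n) (m^n>0 2 n) ⟩
  2 ^ n + 2 ^ n  ≡⟨ cong (2 ^ n +_) (+-identityʳ (2 ^ n)) ⟨
  2 ^ suc n      ∎
  where open ≤-Reasoning

mutual
  length-downs : {B : Set} (t : Trie B) → length (downs t) ≡ size t
  length-downs (node cs) = cong suc (length-downsL cs)

  length-downsL : {B : Set} (cs : List (B × Trie B)) → length (downsL cs) ≡ sizeL cs
  length-downsL [] = refl
  length-downsL ((a , t) ∷ cs) = begin
    length (map (a ∷_) (downs t) ++ downsL cs)
      ≡⟨ length-++ (map (a ∷_) (downs t)) ⟩
    length (map (a ∷_) (downs t)) + length (downsL cs)
      ≡⟨ cong₂ _+_ (trans (length-map (a ∷_) (downs t)) (length-downs t)) (length-downsL cs) ⟩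
    size t + sizeL cs ∎
    where open ≡-Reasoning

allDowns : {B : Set} → Trie B → List (List B)
allDowns t = concatMap downs (subtrees t)

allDownsL : {B : Set} → List (B × Trie B) → List (List B)
allDownsL cs = concatMap downs (subtreesL cs)

mutual
  length-allDowns≤size² : {B : Set} (t : Trie B) → length (allDowns t) ≤ size t * size t
  length-allDowns≤size² (node cs) = begin
    length (downs (node cs) ++ allDownsL cs)      ≡⟨ length-++ (downs (node cs)) ⟩
    length (downs (node cs)) + length (allDownsL cs)
      ≡⟨ cong (_+ length (allDownsL cs)) (length-downs (node cs)) ⟩
    suc r + length (allDownsL cs)                 ≤⟨ +-monoʳ-≤ (suc r) (length-allDowns≤sizeL² cs) ⟩
    suc r + r * r                                 ≤⟨ +-monoʳ-≤ (suc r) (*-monoʳ-≤ r (n≤1+n r)) ⟩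
    suc r * suc r                                 ∎
    where
    open ≤-Reasoning
    r : ℕ
    r = sizeL cs

  length-allDowns≤sizeL² : {B : Set} (cs : List (B × Trie B)) → length (allDownsL cs) ≤ sizeL cs * sizeL cs
  length-allDowns≤sizeL² [] = z≤n
  length-allDowns≤sizeL² ((a , t) ∷ cs) = begin
    length (concatMap downs (subtrees t ++ subtreesL cs))
      ≡⟨ cong length (concatMap-++ downs (subtrees t) (subtreesL cs)) ⟩
    length (allDowns t ++ allDownsL cs)           ≡⟨ length-++ (allDowns t) ⟩
    length (allDowns t) + length (allDownsL cs)
      ≤⟨ +-mono-≤ (length-allDowns≤size² t) (length-allDowns≤sizeL² cs) ⟩
    size t * size t + sizeL cs * sizeL cs         ≤⟨ m²+n²≤[m+n]² (size t) (sizeL cs) ⟩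
    (size t + sizeL cs) * (size t + sizeL cs)     ∎
    where open ≤-Reasoning

mutual
  size-mapT : {B C : Set} (f : B → C) (t : Trie B) → size (mapT f t) ≡ size t
  size-mapT f (node cs) = cong suc (size-mapL f cs)

  size-mapL : {B C : Set} (f : B → C) (cs : List (B × Trie B)) → sizeL (mapL f cs) ≡ sizeL cs
  size-mapL f [] = refl
  size-mapL f ((a , t) ∷ cs) = cong₂ _+_ (size-mapT f t) (size-mapL f cs)

size>0 : {B : Set} (t : Trie B) → 0 < size t
size>0 (node cs) = s≤s z≤n

size-augment : {A : Set} (T : Trie A) → size (augment T) ≡ suc (size T)
size-augment T = cong suc (trans (+-identityʳ _) (size-mapT just T))

length-Substr≤4size² : {A : Set} (T : Trie A) → length (Substr T) ≤ 4 * (size T * size T)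
length-Substr≤4size² T = begin
  length (Substr T)                                   ≡⟨ length-map reverse (allDowns (augment T)) ⟩
  length (allDowns (augment T))                       ≤⟨ length-allDowns≤size² (augment T) ⟩
  size (augment T) * size (augment T)                 ≡⟨ cong (λ s → s * s) (size-augment T) ⟩
  suc n * suc n                                       ≤⟨ *-mono-≤ 1+n≤2n 1+n≤2n ⟩
  (2 * n) * (2 * n)
    ≡⟨ solve 1 (λ n → (con 2 :* n) :* (con 2 :* n) := con 4 :* (n :* n)) refl n ⟩
  4 * (n * n)                                         ∎
  where
  open ≤-Reasoning
  open +-*-Solver
  n : ℕ
  n = size T
  1+n≤2n : suc n ≤ 2 * n
  1+n≤2n = subst (suc n ≤_) (cong (n +_) (sym (+-identityʳ n))) (+-monoˡ-≤ n (size>0 T))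

mutual
  leafDowns⊆downs : {B : Set} (t : Trie B) {d : List B} → d ∈ leafDowns t → d ∈ downs t
  leafDowns⊆downs (node []) (here refl) = here refl
  leafDowns⊆downs (node (c ∷ cs)) d∈ = there (leafDownsL⊆downsL (c ∷ cs) d∈)

  leafDownsL⊆downsL : {B : Set} (cs : List (B × Trie B)) {d : List B} → d ∈ leafDownsL cs → d ∈ downsL cs
  leafDownsL⊆downsL ((a , t) ∷ cs) d∈ with ∈-++⁻ (map (a ∷_) (leafDowns t)) d∈
  ... | inj₁ d∈t with _ , d′∈ , refl ← ∈-map⁻ (a ∷_) d∈t =
    ∈-++⁺ˡ (∈-map⁺ (a ∷_) (leafDowns⊆downs t d′∈))
  ... | inj₂ d∈cs = ∈-++⁺ʳ (map (a ∷_) (downs t)) (leafDownsL⊆downsL cs d∈cs)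

mutual
  downs-extendsTo-leafDowns : {B : Set} (t : Trie B) {d : List B} → d ∈ downs t →
                              Σ (List B) λ e → (d ++ e) ∈ leafDowns t
  downs-extendsTo-leafDowns (node []) (here refl) = [] , here refl
  downs-extendsTo-leafDowns (node ((a , node ds) ∷ cs)) (here refl) =
    let e , e∈ = downs-extendsTo-leafDowns (node ds) (here refl) in a ∷ e , ∈-++⁺ˡ (∈-map⁺ (a ∷_) e∈)
  downs-extendsTo-leafDowns (node (c ∷ cs)) (there d∈) = downsL-extendsTo-leafDownsL (c ∷ cs) d∈

  downsL-extendsTo-leafDownsL : {B : Set} (cs : List (B × Trie B)) {d : List B} → d ∈ downsL cs →
                                Σ (List B) λ e → (d ++ e) ∈ leafDownsL cs
  downsL-extendsTo-leafDownsL ((a , t) ∷ cs) d∈ with ∈-++⁻ (map (a ∷_) (downs t)) d∈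
  ... | inj₁ d∈t with _ , d′∈ , refl ← ∈-map⁻ (a ∷_) d∈t =
    let e , d′e∈ = downs-extendsTo-leafDowns t d′∈ in e , ∈-++⁺ˡ (∈-map⁺ (a ∷_) d′e∈)
  ... | inj₂ d∈cs =
    let e , de∈ = downsL-extendsTo-leafDownsL cs d∈cs in e , ∈-++⁺ʳ (map (a ∷_) (leafDowns t)) de∈

module _ {A : Set} (T : Trie A) where

  reverse-downs∈Substr : ∀ {t d} → t ∈ subtrees (augment T) → d ∈ downs t → reverse d ∈ Substr T
  reverse-downs∈Substr t∈ d∈ = ∈-map⁺ reverse (∈-concatMap⁺ downs (lose t∈ d∈))

  reverse-leafDowns-leftMaximal : ∀ {t d} → t ∈ subtrees (augment T) → d ∈ leafDowns t →
                                  LeftMaximal T (reverse d)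
  reverse-leafDowns-leftMaximal {t} t∈ d∈ =
    reverse-downs∈Substr t∈ (leafDowns⊆downs t d∈) ,
    inj₂ (∈-map⁺ reverse (∈-concatMap⁺ leafDowns (lose t∈ d∈)))

  Substr-extendsTo-leftMaximal : ∀ {Y} → Y ∈ Substr T → Σ (List (Char A)) λ γ → LeftMaximal T (γ ++ Y)
  Substr-extendsTo-leftMaximal Y∈
    with d , d∈ , refl ← ∈-map⁻ reverse Y∈
    with t , t∈ , d∈t ← find (∈-concatMap⁻ downs d∈)
    with e , de∈ ← downs-extendsTo-leafDowns t d∈t
    = reverse e , subst (LeftMaximal T) (reverse-++ d e) (reverse-leafDowns-leftMaximal t∈ de∈)

  -- Left-maximality need not be decidable, so the shortest left-maximal extension exists only up to
  -- double negation; that suffices, as it is only ever used to refute an equality.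
  ¬¬-lmxml : ∀ {Y} → Y ∈ Substr T → ¬ ¬ (Σ (List (Char A)) λ Z → IsLMxml T Y Z)
  ¬¬-lmxml {Y} Y∈ noLmxml =
    let γ , γY-max = Substr-extendsTo-leftMaximal Y∈ in
    ¬¬-least Extension (length γ) (γ , refl , γY-max) λ where
      (_ , (γ₀ , refl , γ₀Y-max) , least) →
        noLmxml (γ₀ ++ Y , γ₀ , refl , γ₀Y-max ,
                 λ γ′ γ′Y-max → least (length γ′) (γ′ , refl , γ′Y-max))
    where
    Extension : ℕ → Set
    Extension n = Σ (List (Char A)) λ γ → length γ ≡ n × LeftMaximal T (γ ++ Y)

  ¬¬-Equiv-refl : ∀ {Y} → Y ∈ Substr T → ¬ ¬ Equiv T Y Y
  ¬¬-Equiv-refl Y∈ inequiv = ¬¬-lmxml Y∈ λ (Z , Y↦Z) → inequiv (Z , Y↦Z , Y↦Z)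

  inequivalent⇒≢ : ∀ {Y Y′} → Y ∈ Substr T → ¬ Equiv T Y Y′ → Y ≢ Y′
  inequivalent⇒≢ Y∈ inequiv refl = ¬¬-Equiv-refl Y∈ inequiv

  lmxml-of-leftMaximal : ∀ {Y Z} → LeftMaximal T Y → IsLMxml T Y Z → Z ≡ Y
  lmxml-of-leftMaximal Y-max ([] , refl , _) = refl
  lmxml-of-leftMaximal Y-max (_ ∷ _ , refl , _ , least) with () ← least [] Y-max

  equivalent-leftMaximal⇒≡ : ∀ {Y Y′} → LeftMaximal T Y → LeftMaximal T Y′ →
                             Equiv T Y Y′ → Y ≡ Y′
  equivalent-leftMaximal⇒≡ Y-max Y′-max (Z , Y↦Z , Y′↦Z) =
    trans (sym (lmxml-of-leftMaximal Y-max Y↦Z)) (lmxml-of-leftMaximal Y′-max Y′↦Z)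

module _ {A : Set} (T : Trie A) where

  distinctNodes⇒Unique : ∀ {L} → DistinctNodes T L → Unique L
  distinctNodes⇒Unique (L⊆ , inequiv) =
    AllPairs-map-restricted (λ Y∈ _ → inequivalent⇒≢ T Y∈) L⊆ inequiv

  #distinctNodes≤#Substr : ∀ L → DistinctNodes T L → length L ≤ length (Substr T)
  #distinctNodes≤#Substr L nodes = Unique⇒length≤ (distinctNodes⇒Unique nodes) (proj₁ nodes)

  target : List (Char A) × A → List (Char A)
  target (Y , a) = Y ++ [ just a ]

  distinctEdges⇒distinctTargets : ∀ {e e′} → IsEdge T e → IsEdge T e′ → ¬ SameEdge T e e′ →
                                  target e ≢ target e′
  distinctEdges⇒distinctTargets {Y , _} {Y′ , _} (Y∈ , Ya∈) _ different eq
    with refl , refl ← ∷ʳ-injective Y Y′ eq =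
    ¬¬-Equiv-refl T Y∈ λ Y≡Y → ¬¬-Equiv-refl T Ya∈ λ Ya≡Ya → different (Y≡Y , refl , Ya≡Ya)

  #distinctEdges≤#Substr : ∀ E → DistinctEdges T E → length E ≤ length (Substr T)
  #distinctEdges≤#Substr E (edges , different) =
    subst (_≤ length (Substr T)) (length-map target E)
      (Unique⇒length≤ (AllPairs.map⁺ (AllPairs-map-restricted distinctEdges⇒distinctTargets edges different))
                      (All.map⁺ (All.map proj₂ edges)))

  leftMaximals⇒distinctNodes : ∀ {L} → All (LeftMaximal T) L → Unique L → DistinctNodes T L
  leftMaximals⇒distinctNodes maximal unique =
    All.map proj₁ maximal ,
    AllPairs-map-restricted
      (λ Y-max Y′-max Y≢Y′ equiv → Y≢Y′ (equivalent-leftMaximal⇒≡ T Y-max Y′-max equiv))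
      maximal unique

  leftMaximals⇒distinctEdges : ∀ a {Ys} → All (λ Y → LeftMaximal T Y × LeftMaximal T (Y ++ [ just a ])) Ys →
                               Unique Ys → DistinctEdges T (map (_, a) Ys)
  leftMaximals⇒distinctEdges a maximal unique =
    All.map⁺ (All.map (λ (Y-max , Ya-max) → proj₁ Y-max , proj₁ Ya-max) maximal) ,
    AllPairs.map⁺ (AllPairs-map-restricted
      (λ (_ , Ya-max) (_ , Y′a-max) Y≢Y′ (_ , _ , equiv) →
         Y≢Y′ (proj₁ (∷ʳ-injective _ _ (equivalent-leftMaximal⇒≡ T Ya-max Y′a-max equiv))))
      maximal unique)

module _ {B : Set} (x y : B) where

  complete : ℕ → Trie B
  complete zero = node []
  complete (suc k) = node ((x , complete k) ∷ (y , complete k) ∷ [])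

  leafDowns-complete : ∀ k → leafDowns (complete (suc k)) ≡
                             map (x ∷_) (leafDowns (complete k)) ++ map (y ∷_) (leafDowns (complete k))
  leafDowns-complete k = cong (map (x ∷_) (leafDowns (complete k)) ++_) (++-identityʳ _)

  length-leafDowns-complete : ∀ k → length (leafDowns (complete k)) ≡ 2 ^ k
  length-leafDowns-complete zero = refl
  length-leafDowns-complete (suc k) = begin
    length (leafDowns (complete (suc k)))                         ≡⟨ cong length (leafDowns-complete k) ⟩
    length (map (x ∷_) codes ++ map (y ∷_) codes)                 ≡⟨ length-++ (map (x ∷_) codes) ⟩
    length (map (x ∷_) codes) + length (map (y ∷_) codes)
      ≡⟨ cong₂ _+_ (length-map (x ∷_) codes) (length-map (y ∷_) codes) ⟩
    length codes + length codes
      ≡⟨ cong (λ n → n + n) (length-leafDowns-complete k) ⟩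
    2 ^ k + 2 ^ k                                                 ≡⟨ cong (2 ^ k +_) (+-identityʳ (2 ^ k)) ⟨
    2 ^ suc k                                                     ∎
    where
    open ≡-Reasoning
    codes : List (List B)
    codes = leafDowns (complete k)

  leafDowns-complete-length : ∀ k → All (λ c → length c ≡ k) (leafDowns (complete k))
  leafDowns-complete-length zero = refl ∷ []
  leafDowns-complete-length (suc k) rewrite leafDowns-complete k =
    All.++⁺ (All.map⁺ (All.map (cong suc) (leafDowns-complete-length k)))
            (All.map⁺ (All.map (cong suc) (leafDowns-complete-length k)))

  leafDowns-complete-unique : x ≢ y → ∀ k → Unique (leafDowns (complete k))
  leafDowns-complete-unique x≢y zero = [] ∷ []
  leafDowns-complete-unique x≢y (suc k) rewrite leafDowns-complete k =
    Unique.++⁺ (Unique.map⁺ (λ eq → proj₂ (∷-injective eq)) (leafDowns-complete-unique x≢y k))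
               (Unique.map⁺ (λ eq → proj₂ (∷-injective eq)) (leafDowns-complete-unique x≢y k))
               disjoint
    where
    disjoint : ∀ {d} → ¬ (d ∈ map (x ∷_) (leafDowns (complete k)) ×
                          d ∈ map (y ∷_) (leafDowns (complete k)))
    disjoint (d∈x , d∈y)
      with _ , _ , refl ← ∈-map⁻ (x ∷_) d∈x
      with _ , _ , eq ← ∈-map⁻ (y ∷_) d∈y
      = x≢y (proj₁ (∷-injective eq))

  complete-wellFormed : x ≢ y → ∀ k → WellFormed (complete k)
  complete-wellFormed x≢y zero = wf [] []
  complete-wellFormed x≢y (suc k) =
    wf ((x≢y ∷ []) ∷ [] ∷ []) (complete-wellFormed x≢y k ∷ complete-wellFormed x≢y k ∷ [])

  size-complete : ∀ k → suc (size (complete k)) ≡ 2 ^ suc k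
  size-complete zero = refl
  size-complete (suc k) = begin
    suc (suc (s + (s + 0)))      ≡⟨ cong suc (+-suc s (s + 0)) ⟨
    suc s + (suc s + 0)          ≡⟨ cong (λ n → n + (n + 0)) (size-complete k) ⟩
    2 ^ suc (suc k)              ∎
    where
    open ≡-Reasoning
    s : ℕ
    s = size (complete k)

module _ {B : Set} (x : B) where

  spine : ℕ → Trie B → Trie B
  spine zero t = t
  spine (suc i) t = node [ (x , spine i t) ]

  leafDowns-spine : ∀ i t {d} → d ∈ leafDowns t → (replicate i x ++ d) ∈ leafDowns (spine i t)
  leafDowns-spine zero t d∈ = d∈
  leafDowns-spine (suc i) t d∈ = ∈-++⁺ˡ (∈-map⁺ (x ∷_) (leafDowns-spine i t d∈))

  spine-∈-subtrees : ∀ {j} i t → j ≤ i → spine j t ∈ subtrees (spine i t)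
  spine-∈-subtrees zero (node _) z≤n = here refl
  spine-∈-subtrees (suc i) t j≤1+i with m≤n⇒m<n∨m≡n j≤1+i
  ... | inj₂ refl = here refl
  ... | inj₁ (s≤s j≤i) = there (∈-++⁺ˡ (spine-∈-subtrees i t j≤i))

  size-spine : ∀ i t → size (spine i t) ≡ i + size t
  size-spine zero t = refl
  size-spine (suc i) t = cong suc (trans (+-identityʳ _) (size-spine i t))

  spine-wellFormed : ∀ i {t} → WellFormed t → WellFormed (spine i t)
  spine-wellFormed zero t-wf = t-wf
  spine-wellFormed (suc i) t-wf = wf ([] ∷ []) (spine-wellFormed i t-wf ∷ [])

  stacked : List (List B) → ℕ → List (List B)
  stacked cs zero = cs
  stacked cs (suc i) = map (replicate (suc i) x ++_) cs ++ stacked cs i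

  ∈-stacked⁻ : ∀ {cs d} i → d ∈ stacked cs i →
               Σ ℕ λ j → j ≤ i × Σ (List B) λ c → c ∈ cs × d ≡ replicate j x ++ c
  ∈-stacked⁻ zero d∈ = 0 , z≤n , _ , d∈ , refl
  ∈-stacked⁻ {cs} (suc i) d∈ with ∈-++⁻ (map (replicate (suc i) x ++_) cs) d∈
  ... | inj₁ d∈top with c , c∈ , refl ← ∈-map⁻ (replicate (suc i) x ++_) d∈top =
    suc i , ≤-refl , c , c∈ , refl
  ... | inj₂ d∈rest with j , j≤i , c , c∈ , refl ← ∈-stacked⁻ i d∈rest =
    j , m≤n⇒m≤1+n j≤i , c , c∈ , refl

  length-stacked : ∀ cs i → length (stacked cs i) ≡ suc i * length cs
  length-stacked cs zero = sym (+-identityʳ (length cs))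
  length-stacked cs (suc i) = begin
    length (map pad cs ++ stacked cs i)           ≡⟨ length-++ (map pad cs) ⟩
    length (map pad cs) + length (stacked cs i)   ≡⟨ cong₂ _+_ (length-map pad cs) (length-stacked cs i) ⟩
    length cs + suc i * length cs                 ∎
    where
    open ≡-Reasoning
    pad : List B → List B
    pad = replicate (suc i) x ++_

  length-replicate-++ : ∀ j {k c} → length c ≡ k → length (replicate j x ++ c) ≡ j + k
  length-replicate-++ j {c = c} refl = trans (length-++ (replicate j x)) (cong (_+ length c) (length-replicate j))

  stacked-unique : ∀ {k cs} → All (λ c → length c ≡ k) cs → Unique cs → ∀ i → Unique (stacked cs i)
  stacked-unique lengths unique zero = unique
  stacked-unique {k} {cs} lengths unique (suc i) =
    Unique.++⁺ (Unique.map⁺ (++-cancelˡ (replicate (suc i) x) _ _) unique)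
               (stacked-unique lengths unique i) disjoint
    where
    length≡ : ∀ {j c} → c ∈ cs → length (replicate j x ++ c) ≡ j + k
    length≡ {j} c∈ = length-replicate-++ j (All.lookup lengths c∈)

    disjoint : ∀ {d} → ¬ (d ∈ map (replicate (suc i) x ++_) cs × d ∈ stacked cs i)
    disjoint (d∈top , d∈rest)
      with c , c∈ , refl ← ∈-map⁻ (replicate (suc i) x ++_) d∈top
      with j , j≤i , c′ , c′∈ , eq ← ∈-stacked⁻ i d∈rest
      = <⇒≱ (s≤s (+-monoˡ-≤ k j≤i))
            (≤-reflexive (trans (sym (length≡ c∈)) (trans (cong length eq) (length≡ c′∈))))

mapT-complete : {B C : Set} (f : B → C) (x y : B) (k : ℕ) → mapT f (complete x y k) ≡ complete (f x) (f y) k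
mapT-complete f x y zero = refl
mapT-complete f x y (suc k) = cong (λ t → node ((f x , t) ∷ (f y , t) ∷ [])) (mapT-complete f x y k)

mapT-spine : {B C : Set} (f : B → C) (x : B) (i : ℕ) (t : Trie B) →
             mapT f (spine x i t) ≡ spine (f x) i (mapT f t)
mapT-spine f x zero t = refl
mapT-spine f x (suc i) t = cong (λ s → node [ (f x , s) ]) (mapT-spine f x i t)

module Broom (σ k : ℕ) where

  x y : Fin (suc (suc σ))
  x = fzero
  y = fsuc fzero

  p : ℕ
  p = 2 ^ k

  T : Trie (Fin (suc (suc σ)))
  T = spine x (suc p) (complete x y k)

  T-wellFormed : WellFormed T
  T-wellFormed = spine-wellFormed x (suc p) (complete-wellFormed x y (λ ()) k)

  size-T : size T ≡ 3 * p
  size-T = begin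
    size T                           ≡⟨ size-spine x (suc p) (complete x y k) ⟩
    suc p + size (complete x y k)    ≡⟨ +-suc p (size (complete x y k)) ⟨
    p + suc (size (complete x y k))  ≡⟨ cong (p +_) (size-complete x y k) ⟩
    3 * p                            ∎
    where open ≡-Reasoning

  k<size-T : k < size T
  k<size-T = subst (k <_) (sym size-T) (≤-trans (n<2^n k) (m≤m+n p (p + (p + 0))))

  X : Char (Fin (suc (suc σ)))
  X = just x

  complete⁺ : Trie (Char (Fin (suc (suc σ))))
  complete⁺ = complete X (just y) k

  codes : List (List (Char (Fin (suc (suc σ)))))
  codes = leafDowns complete⁺

  augment-T : mapT just T ≡ spine X (suc p) complete⁺
  augment-T = trans (mapT-spine just x (suc p) (complete x y k)) (cong (spine X (suc p)) (mapT-complete just x y k))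

  padded-leftMaximal : ∀ {j c} → j ≤ suc p → c ∈ codes → LeftMaximal T (reverse (replicate j X ++ c))
  padded-leftMaximal {j} j≤ c∈ =
    reverse-leafDowns-leftMaximal T (there (∈-++⁺ˡ spine-j∈)) (leafDowns-spine X j complete⁺ c∈)
    where
    spine-j∈ : spine X j complete⁺ ∈ subtrees (mapT just T)
    spine-j∈ = subst (λ t → spine X j complete⁺ ∈ subtrees t) (sym augment-T)
                     (spine-∈-subtrees X (suc p) complete⁺ j≤)

  strings : ℕ → List (List (Char (Fin (suc (suc σ)))))
  strings i = map reverse (stacked X codes i)

  strings-unique : ∀ i → Unique (strings i)
  strings-unique i =
    Unique.map⁺ reverse-injective
      (stacked-unique X (leafDowns-complete-length X (just y) k)
                        (leafDowns-complete-unique X (just y) (λ ()) k) i)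

  strings-leftMaximal : ∀ {i} → i ≤ suc p → All (LeftMaximal T) (strings i)
  strings-leftMaximal {i} i≤ = All.map⁺ (All.tabulate stacked-leftMaximal)
    where
    stacked-leftMaximal : ∀ {d} → d ∈ stacked X codes i → LeftMaximal T (reverse d)
    stacked-leftMaximal d∈ with j , j≤i , c , c∈ , refl ← ∈-stacked⁻ X i d∈ =
      padded-leftMaximal (≤-trans j≤i i≤) c∈

  strings-extend-leftMaximal : All (λ Y → LeftMaximal T Y × LeftMaximal T (Y ++ [ X ])) (strings p)
  strings-extend-leftMaximal = All.map⁺ (All.tabulate stacked-leftMaximal)
    where
    stacked-leftMaximal : ∀ {d} → d ∈ stacked X codes p →
                          LeftMaximal T (reverse d) × LeftMaximal T (reverse d ++ [ X ])
    stacked-leftMaximal d∈ with j , j≤p , c , c∈ , refl ← ∈-stacked⁻ X p d∈ =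
      padded-leftMaximal (m≤n⇒m≤1+n j≤p) c∈ ,
      subst (LeftMaximal T) (unfold-reverse X (replicate j X ++ c)) (padded-leftMaximal (s≤s j≤p) c∈)

  size²≤9*#strings : ∀ i → p ≤ i → size T * size T ≤ 9 * length (strings i)
  size²≤9*#strings i p≤i = begin
    size T * size T              ≡⟨ cong (λ n → n * n) size-T ⟩
    (3 * p) * (3 * p)
      ≡⟨ solve 1 (λ p → (con 3 :* p) :* (con 3 :* p) := con 9 :* (p :* p)) refl p ⟩
    9 * (p * p)                  ≤⟨ *-monoʳ-≤ 9 (*-monoˡ-≤ p (m≤n⇒m≤1+n p≤i)) ⟩
    9 * (suc i * p)              ≡⟨ cong (9 *_) length-strings ⟨
    9 * length (strings i)       ∎
    where
    open ≤-Reasoning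
    open +-*-Solver
    length-strings : length (strings i) ≡ suc i * p
    length-strings = begin-equality
      length (strings i)          ≡⟨ length-map reverse (stacked X codes i) ⟩
      length (stacked X codes i)  ≡⟨ length-stacked X codes i ⟩
      suc i * length codes        ≡⟨ cong (suc i *_) (length-leafDowns-complete X (just y) k) ⟩
      suc i * p                   ∎

  nodes : DistinctNodes T (strings (suc p))
  nodes = leftMaximals⇒distinctNodes T (strings-leftMaximal ≤-refl) (strings-unique (suc p))

  edges : DistinctEdges T (map (_, x) (strings p))
  edges = leftMaximals⇒distinctEdges T x strings-extend-leftMaximal (strings-unique p)

  size²≤9*#edges : size T * size T ≤ 9 * length (map (_, x) (strings p))
  size²≤9*#edges =
    subst (λ n → size T * size T ≤ 9 * n) (sym (length-map (_, x) (strings p))) (size²≤9*#strings p ≤-refl)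

theorem5 :
    (Σ ℕ λ c → ∀ (A : Set) (T : Trie A) → WellFormed T →
        (∀ L → DistinctNodes T L → length L ≤ c * (size T * size T)) ×
        (∀ E → DistinctEdges T E → length E ≤ c * (size T * size T)))
    ×
    (Σ ℕ λ σ₀ → ∀ (σ : ℕ) → σ₀ ≤ σ → Σ ℕ λ c → ∀ (N : ℕ) →
        Σ (Trie (Fin σ)) λ T → WellFormed T × N ≤ size T ×
          (Σ (List (List (Char (Fin σ)))) λ L →
              DistinctNodes T L × size T * size T ≤ c * length L) ×
          (Σ (List (List (Char (Fin σ)) × Fin σ)) λ E →
              DistinctEdges T E × size T * size T ≤ c * length E))
theorem5 =
  (4 , λ A T _ →
    (λ L nodes → ≤-trans (#distinctNodes≤#Substr T L nodes) (length-Substr≤4size² T)) ,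
    (λ E edges → ≤-trans (#distinctEdges≤#Substr T E edges) (length-Substr≤4size² T))) ,
  (2 , λ where
    (suc (suc σ)) (s≤s (s≤s z≤n)) → 9 , λ N → let open Broom σ N in
      T , T-wellFormed , <⇒≤ k<size-T ,
      (strings (suc p) , nodes , size²≤9*#strings (suc p) (n≤1+n p)) ,
      (map (_, x) (strings p) , edges , size²≤9*#edges))
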